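{- For every positive integer $n$, $e[n]<\lceil\log_2 n\rceil+1$.
   Context: For an integer $n\ge1$, $e[n]$ is the expected number of fair coin tosses used by the bit-efficient scheme for choosing one of $n$ options uniformly. The scheme maintains a set of undecided equally likely toss sequences of the current length $t$ (probability $2^{ -t}$ each), starting with the empty sequence; if $n=1$, it stops immediately, so $e[1]=0$. After each toss, each undecided sequence splits into its two extensions. If there are now at least $n$ undecided sequences, $n$ of them are assigned one to each option, and the process stops if the observed sequence is among them; the rest remain undecided. Thus after $t$ tosses exactly $2^t\bmod n$ sequences are undecided. -}

module Defs where

open import Data.Nat using (ℕ; zero; suc; _∸_; _^_; NonZero)
import Data.Nat as ℕ
open import Data.Nat.DivMod using (_%_)
open import Data.Nat.Properties using (m^n≢0)
open import Data.Integer using (+_)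
open import Data.Rational using (ℚ; _/_; _+_; 0ℚ)

-- Number of undecided toss sequences after t tosses when choosing among n options:
-- u n t = 2^t mod n  (for n = 1 this is 0 already at t = 0: the scheme stops at once).
undecided : (n : ℕ) → .{{NonZero n}} → ℕ → ℕ
undecided n t = (2 ^ t) % n

-- Number of length-t sequences at which the process stops exactly after t tosses
-- (t ≥ 1): the 2·u(t-1) extensions of the undecided sequences minus those still undecided.
stopsAt : (n : ℕ) → .{{NonZero n}} → ℕ → ℕ
stopsAt n zero    = 0
stopsAt n (suc t) = 2 ℕ.* undecided n t ∸ undecided n (suc t)

term : (n : ℕ) → .{{NonZero n}} → ℕ → ℚ
term n t = (+ (t ℕ.* stopsAt n t) / (2 ^ t)) {{m^n≢0 2 t}}

-- Partial sum  Σ_{t < T} t · P(stop after exactly t tosses).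
-- The expectation e[n] is the limit (= supremum, terms are ≥ 0) of these partial sums.
partialE : (n : ℕ) → .{{NonZero n}} → ℕ → ℚ
partialE n zero    = 0ℚ
partialE n (suc T) = partialE n T + term n T

{-# OPTIONS --safe #-}
module Submission where

-- Let u t = 2^t mod n and k = ⌈log₂ n⌉.  Summing by parts, the T-th partial sum of e[n]
-- is at most Σ_{t<T} u t / 2^t, the expected number of tosses of the scheme cut off
-- after T tosses.  Nothing is decided before k tosses, so u t = 2^t for t < k and these
-- partial sums are T ≤ k there.  From then on the potential
-- Σ_{t<T} u t / 2^t + (u T + n - 1) / 2^T cannot increase, as u (T + 1) ≤ n - 1, and at
-- T = k it is at most k + 1 - 1/2^k, as u k + n ≤ 2^k.  So ε = 1/2^k works.

open import Defs
open import Data.Nat using (ℕ; NonZero)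

-- The anonymous modules keep the ℕ operators out of the top-level scope, where the
-- statement needs the ℚ ones.
module _ where
  open import Data.Nat
  open import Data.Nat.Properties
  open import Data.Nat.DivMod using (_%_; m%n≤m; %-distribˡ-+; m≤n⇒[n∸m]%m≡n%m)
  open import Data.Nat.Logarithm using (⌈log₂_⌉; ⌈log₂⌉-mono-≤; ⌈log₂2^n⌉≡n)
  open import Data.Nat.Logarithm.Core using (⌈log2⌉)
  open import Data.Nat.Induction using (<-wellFounded)
  open import Induction.WellFounded using (Acc; acc)
  open import Relation.Binary.PropositionalEquality

  m≤2*⌈m/2⌉ : ∀ m → m ≤ 2 * ⌈ m /2⌉
  m≤2*⌈m/2⌉ m = begin
    m                    ≡⟨ ⌊n/2⌋+⌈n/2⌉≡n m ⟨
    ⌊ m /2⌋ + ⌈ m /2⌉    ≤⟨ +-monoˡ-≤ ⌈ m /2⌉ (⌊n/2⌋≤⌈n/2⌉ m) ⟩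
    ⌈ m /2⌉ + ⌈ m /2⌉    ≡⟨ cong (⌈ m /2⌉ +_) (+-identityʳ ⌈ m /2⌉) ⟨
    2 * ⌈ m /2⌉          ∎
    where open ≤-Reasoning

  n≤2^⌈log₂n⌉ : ∀ n → n ≤ 2 ^ ⌈log₂ n ⌉
  n≤2^⌈log₂n⌉ n = n≤2^⌈log2⌉ n (<-wellFounded n)
    where
    n≤2^⌈log2⌉ : ∀ m (rec : Acc _<_ m) → m ≤ 2 ^ ⌈log2⌉ m rec
    n≤2^⌈log2⌉ 0             _        = z≤n
    n≤2^⌈log2⌉ 1             _        = s≤s z≤n
    n≤2^⌈log2⌉ (suc (suc m)) (acc rs) =
      ≤-trans (m≤2*⌈m/2⌉ (2 + m)) (*-monoʳ-≤ 2 (n≤2^⌈log2⌉ (suc ⌈ m /2⌉) _))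

  <⌈log₂n⌉⇒2^<n : ∀ {n t} → t < ⌈log₂ n ⌉ → 2 ^ t < n
  <⌈log₂n⌉⇒2^<n {n} {t} t<⌈log₂n⌉ = ≰⇒> λ n≤2^t →
    <⇒≱ t<⌈log₂n⌉ (subst (⌈log₂ n ⌉ ≤_) (⌈log₂2^n⌉≡n t) (⌈log₂⌉-mono-≤ n≤2^t))

  [2*m]%n≤2*[m%n] : ∀ m n .{{_ : NonZero n}} → (2 * m) % n ≤ 2 * (m % n)
  [2*m]%n≤2*[m%n] m n = begin
    (2 * m) % n              ≡⟨ cong (λ x → (m + x) % n) (+-identityʳ m) ⟩
    (m + m) % n              ≡⟨ %-distribˡ-+ m m n ⟩
    (m % n + m % n) % n      ≤⟨ m%n≤m (m % n + m % n) n ⟩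
    m % n + m % n            ≡⟨ cong (m % n +_) (+-identityʳ (m % n)) ⟨
    2 * (m % n)              ∎
    where open ≤-Reasoning

  m%n+n≤m : ∀ m n .{{_ : NonZero n}} → n ≤ m → m % n + n ≤ m
  m%n+n≤m m n n≤m = begin
    m % n + n              ≡⟨ cong (_+ n) (m≤n⇒[n∸m]%m≡n%m n≤m) ⟨
    (m ∸ n) % n + n        ≤⟨ +-monoˡ-≤ n (m%n≤m (m ∸ n) n) ⟩
    m ∸ n + n              ≡⟨ m∸n+n≡m n≤m ⟩
    m                      ∎
    where open ≤-Reasoning

  f[k+j]+2^j≤2^j*f[k]+1 : (f : ℕ → ℕ) → (∀ t → f (suc t) + 1 ≤ 2 * f t) →
                          ∀ k j → f (k + j) + 2 ^ j ≤ 2 ^ j * f k + 1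
  f[k+j]+2^j≤2^j*f[k]+1 f step k zero rewrite +-identityʳ k | *-identityˡ (f k) = ≤-refl
  f[k+j]+2^j≤2^j*f[k]+1 f step k (suc j) rewrite +-suc k j = +-cancelʳ-≤ 1 _ _ (begin
    f (suc (k + j)) + 2 * 2 ^ j + 1     ≡⟨ +-assoc (f (suc (k + j))) (2 * 2 ^ j) 1 ⟩
    f (suc (k + j)) + (2 * 2 ^ j + 1)   ≡⟨ cong (f (suc (k + j)) +_) (+-comm (2 * 2 ^ j) 1) ⟩
    f (suc (k + j)) + (1 + 2 * 2 ^ j)   ≡⟨ +-assoc (f (suc (k + j))) 1 (2 * 2 ^ j) ⟨
    f (suc (k + j)) + 1 + 2 * 2 ^ j     ≤⟨ +-monoˡ-≤ (2 * 2 ^ j) (step (k + j)) ⟩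
    2 * f (k + j) + 2 * 2 ^ j           ≡⟨ *-distribˡ-+ 2 (f (k + j)) (2 ^ j) ⟨
    2 * (f (k + j) + 2 ^ j)             ≤⟨ *-monoʳ-≤ 2 (f[k+j]+2^j≤2^j*f[k]+1 f step k j) ⟩
    2 * (2 ^ j * f k + 1)               ≡⟨ *-distribˡ-+ 2 (2 ^ j * f k) 1 ⟩
    2 * (2 ^ j * f k) + 2               ≡⟨ cong (_+ 2) (*-assoc 2 (2 ^ j) (f k)) ⟨
    2 * 2 ^ j * f k + (1 + 1)           ≡⟨ +-assoc (2 * 2 ^ j * f k) 1 1 ⟨
    2 * 2 ^ j * f k + 1 + 1             ∎)
    where open ≤-Reasoning

module _ where
  open import Data.Nat using (suc; _+_; _*_; _^_; _≤_)
  open import Data.Nat.Properties using (m*n≢0; m^n≢0; *-identityʳ; *-identityˡ; ≤-trans; ≤-reflexive)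
  open import Data.Nat.Tactic.RingSolver using (solve-∀)
  open import Data.Integer using (+_)
  import Data.Integer as ℤ
  open import Data.Integer.Properties using (pos-*; pos-+)
  open import Data.Rational as ℚ using (toℚᵘ)
  open import Data.Rational.Properties using (toℚᵘ-fromℚᵘ; toℚᵘ-homo-+; toℚᵘ-cancel-≤)
  open import Data.Rational.Unnormalised as ℚᵘ using (ℚᵘ; mkℚᵘ; _≃_; *≡*; *≤*)
  open import Data.Rational.Unnormalised.Properties using (≃-trans; +-cong; module ≤-Reasoning)
  open import Relation.Binary.PropositionalEquality

  infix 7 _÷_

  _÷_ : ℕ → (d : ℕ) → .{{NonZero d}} → ℚᵘ
  m ÷ d = + m ℚᵘ./ d

  toℚᵘ-/ : ∀ m d .{{_ : NonZero d}} → toℚᵘ (+ m ℚ./ d) ≃ m ÷ d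
  toℚᵘ-/ m (suc d) = toℚᵘ-fromℚᵘ (mkℚᵘ (+ m) d)

  ÷-+-÷ : ∀ a b c d .{{_ : NonZero b}} .{{_ : NonZero d}} →
          a ÷ b ℚᵘ.+ c ÷ d ≡ ((a * d + c * b) ÷ (b * d)) {{m*n≢0 b d}}
  ÷-+-÷ a b@(suc _) c d@(suc _) = cong (λ z → z ℚᵘ./ (b * d))
    (sym (trans (pos-+ (a * d) (c * b)) (cong₂ ℤ._+_ (pos-* a d) (pos-* c b))))

  ÷-cong : ∀ a b c d .{{_ : NonZero b}} .{{_ : NonZero d}} → a * d ≡ c * b → a ÷ b ≃ c ÷ d
  ÷-cong a (suc b) c (suc d) eq = *≡* (trans (sym (pos-* a (suc d))) (trans (cong +_ eq) (pos-* c (suc b))))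

  ÷-mono-≤ : ∀ a b c d .{{_ : NonZero b}} .{{_ : NonZero d}} → a * d ≤ c * b → a ÷ b ℚᵘ.≤ c ÷ d
  ÷-mono-≤ a (suc b) c (suc d) le = *≤* (subst₂ ℤ._≤_ (pos-* a (suc d)) (pos-* c (suc b)) (ℤ.+≤+ le))

  toℚᵘ-+-/ : ∀ q a b c d .{{_ : NonZero b}} .{{_ : NonZero d}} → toℚᵘ q ≃ a ÷ b →
             toℚᵘ (q ℚ.+ + c ℚ./ d) ≃ ((a * d + c * b) ÷ (b * d)) {{m*n≢0 b d}}
  toℚᵘ-+-/ q a b c d q≃a/b = ≃-trans (toℚᵘ-homo-+ q (+ c ℚ./ d))
    (subst (_ ≃_) (÷-+-÷ a b c d) (+-cong q≃a/b (toℚᵘ-/ c d)))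

  toℚᵘ-+-/2^ : ∀ q a c t → toℚᵘ q ≃ (a ÷ 2 ^ t) {{m^n≢0 2 t}} →
               toℚᵘ (q ℚ.+ (+ c ℚ./ 2 ^ suc t) {{m^n≢0 2 (suc t)}}) ≃
               ((2 * a + c) ÷ 2 ^ suc t) {{m^n≢0 2 (suc t)}}
  toℚᵘ-+-/2^ q a c t q≃a/2^t = ≃-trans (toℚᵘ-+-/ q a (2 ^ t) c (2 ^ suc t) q≃a/2^t)
    (÷-cong _ (2 ^ t * 2 ^ suc t) _ (2 ^ suc t) {{m*n≢0 (2 ^ t) (2 ^ suc t)}} (cross a c (2 ^ t)))
    where
    instance
      2^t≢0 : NonZero (2 ^ t)
      2^t≢0 = m^n≢0 2 t
      2^1+t≢0 : NonZero (2 ^ suc t)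
      2^1+t≢0 = m^n≢0 2 (suc t)
    cross : ∀ a c p → (a * (2 * p) + c * p) * (2 * p) ≡ (2 * a + c) * (p * (2 * p))
    cross = solve-∀

  q+1/c≤m/1 : ∀ q a b c m .{{_ : NonZero b}} .{{_ : NonZero c}} → toℚᵘ q ≃ a ÷ b →
              a * c + b ≤ m * (b * c) → q ℚ.+ + 1 ℚ./ c ℚ.≤ + m ℚ./ 1
  q+1/c≤m/1 q a b c m q≃a/b le = toℚᵘ-cancel-≤ (begin
    toℚᵘ (q ℚ.+ + 1 ℚ./ c)       ≃⟨ toℚᵘ-+-/ q a b 1 c q≃a/b ⟩
    (a * c + 1 * b) ÷ (b * c)    ≤⟨ ÷-mono-≤ _ (b * c) m 1 le′ ⟩
    m ÷ 1                        ≃⟨ toℚᵘ-/ m 1 ⟨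
    toℚᵘ (+ m ℚ./ 1)             ∎)
    where
    open ≤-Reasoning
    instance
      bc≢0 : NonZero (b * c)
      bc≢0 = m*n≢0 b c
    le′ : (a * c + 1 * b) * 1 ≤ m * (b * c)
    le′ = ≤-trans (≤-reflexive (trans (*-identityʳ _) (cong (λ x → a * c + x) (*-identityˡ b)))) le

module Scheme (n : ℕ) .{{_ : NonZero n}} where
  open import Data.Nat
  open import Data.Nat.Properties
  open import Data.Nat.DivMod using (m%n<n; m<n⇒m%n≡m)
  open import Data.Nat.Tactic.RingSolver using (solve-∀)
  open import Data.Product using (_,_)
  open import Data.Sum using (inj₁; inj₂)
  open import Data.Rational using (toℚᵘ)
  open import Data.Rational.Unnormalised using (_≃_)
  open import Data.Rational.Unnormalised.Properties using (≃-refl)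
  open import Relation.Binary.PropositionalEquality

  undecided<n : ∀ t → undecided n t < n
  undecided<n t = m%n<n (2 ^ t) n

  stopsAt+undecided : ∀ t → stopsAt n (suc t) + undecided n (suc t) ≡ 2 * undecided n t
  stopsAt+undecided t = m∸n+n≡m ([2*m]%n≤2*[m%n] (2 ^ t) n)

  partialNumerator : ℕ → ℕ
  partialNumerator zero    = 0
  partialNumerator (suc T) = 2 * partialNumerator T + suc T * stopsAt n (suc T)

  toℚᵘ-partialE : ∀ T → toℚᵘ (partialE n (suc T)) ≃ (partialNumerator T ÷ 2 ^ T) {{m^n≢0 2 T}}
  toℚᵘ-partialE zero    = ≃-refl
  toℚᵘ-partialE (suc T) =
    toℚᵘ-+-/2^ (partialE n (suc T)) (partialNumerator T) (suc T * stopsAt n (suc T)) T (toℚᵘ-partialE T)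

  -- cappedNumerator T / 2^T = Σ_{t<T} undecided n t / 2^t is the expected number of
  -- tosses when the scheme is cut off after T tosses.
  cappedNumerator : ℕ → ℕ
  cappedNumerator zero    = 0
  cappedNumerator (suc T) = 2 * (cappedNumerator T + undecided n T)

  partialNumerator+T*undecided≡cappedNumerator :
    ∀ T → partialNumerator T + T * undecided n T ≡ cappedNumerator T
  partialNumerator+T*undecided≡cappedNumerator zero    = refl
  partialNumerator+T*undecided≡cappedNumerator (suc T) = begin
    2 * r + suc T * s + suc T * u′    ≡⟨ +-assoc (2 * r) (suc T * s) (suc T * u′) ⟩
    2 * r + (suc T * s + suc T * u′)  ≡⟨ cong (2 * r +_) (*-distribˡ-+ (suc T) s u′) ⟨
    2 * r + suc T * (s + u′)          ≡⟨ cong (λ x → 2 * r + suc T * x) (stopsAt+undecided T) ⟩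
    2 * r + suc T * (2 * u)           ≡⟨ regroup r T u ⟩
    2 * (r + T * u + u)               ≡⟨ cong (λ x → 2 * (x + u)) (partialNumerator+T*undecided≡cappedNumerator T) ⟩
    2 * (cappedNumerator T + u)       ∎
    where
    open ≡-Reasoning
    r = partialNumerator T
    s = stopsAt n (suc T)
    u = undecided n T
    u′ = undecided n (suc T)
    regroup : ∀ r T u → 2 * r + suc T * (2 * u) ≡ 2 * (r + T * u + u)
    regroup = solve-∀

  partialNumerator≤cappedNumerator : ∀ T → partialNumerator T ≤ cappedNumerator T
  partialNumerator≤cappedNumerator T = subst (partialNumerator T ≤_)
    (partialNumerator+T*undecided≡cappedNumerator T) (m≤m+n (partialNumerator T) (T * undecided n T))

  potential : ℕ → ℕ
  potential T = cappedNumerator T + undecided n T + n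

  potential[1+T]+1≤2*potential[T] : ∀ T → potential (suc T) + 1 ≤ 2 * potential T
  potential[1+T]+1≤2*potential[T] T = begin
    2 * a + u′ + n + 1    ≡⟨ regroup a u′ n ⟩
    2 * a + n + suc u′    ≤⟨ +-monoʳ-≤ (2 * a + n) (undecided<n (suc T)) ⟩
    2 * a + n + n         ≡⟨ double a n ⟩
    2 * (a + n)           ∎
    where
    open ≤-Reasoning
    a = cappedNumerator T + undecided n T
    u′ = undecided n (suc T)
    regroup : ∀ a u n → 2 * a + u + n + 1 ≡ 2 * a + n + suc u
    regroup = solve-∀
    double : ∀ a n → 2 * a + n + n ≡ 2 * (a + n)
    double = solve-∀

  module Threshold {k : ℕ} (2^<n : ∀ {t} → t < k → 2 ^ t < n) (n≤2^k : n ≤ 2 ^ k) where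

    cappedNumerator≡T*2^T : ∀ {T} → T ≤ k → cappedNumerator T ≡ T * 2 ^ T
    cappedNumerator≡T*2^T {zero}  _   = refl
    cappedNumerator≡T*2^T {suc T} T<k = begin
      2 * (cappedNumerator T + undecided n T)  ≡⟨ cong₂ (λ q u → 2 * (q + u))
                                                    (cappedNumerator≡T*2^T (<⇒≤ T<k)) (m<n⇒m%n≡m (2^<n T<k)) ⟩
      2 * (T * 2 ^ T + 2 ^ T)                  ≡⟨ regroup T (2 ^ T) ⟩
      suc T * (2 * 2 ^ T)                      ∎
      where
      open ≡-Reasoning
      regroup : ∀ T p → 2 * (T * p + p) ≡ suc T * (2 * p)
      regroup = solve-∀

    potential[k]≤[k+1]*2^k : potential k ≤ (k + 1) * 2 ^ k
    potential[k]≤[k+1]*2^k = begin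
      cappedNumerator k + undecided n k + n  ≡⟨ cong (λ q → q + undecided n k + n) (cappedNumerator≡T*2^T ≤-refl) ⟩
      k * 2 ^ k + undecided n k + n          ≡⟨ +-assoc (k * 2 ^ k) (undecided n k) n ⟩
      k * 2 ^ k + (undecided n k + n)        ≤⟨ +-monoʳ-≤ (k * 2 ^ k) (m%n+n≤m (2 ^ k) n n≤2^k) ⟩
      k * 2 ^ k + 2 ^ k                      ≡⟨ regroup k (2 ^ k) ⟩
      (k + 1) * 2 ^ k                        ∎
      where
      open ≤-Reasoning
      regroup : ∀ k p → k * p + p ≡ (k + 1) * p
      regroup = solve-∀

    cappedNumerator[k+j]+2^j≤2^j*[k+1]*2^k : ∀ j → cappedNumerator (k + j) + 2 ^ j ≤ 2 ^ j * ((k + 1) * 2 ^ k)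
    cappedNumerator[k+j]+2^j≤2^j*[k+1]*2^k j = +-cancelʳ-≤ 1 _ _ (begin
      cappedNumerator (k + j) + 2 ^ j + 1        ≤⟨ +-monoʳ-≤ (cappedNumerator (k + j) + 2 ^ j) 1≤u+n ⟩
      cappedNumerator (k + j) + 2 ^ j + (u + n)  ≡⟨ regroup (cappedNumerator (k + j)) (2 ^ j) u n ⟩
      potential (k + j) + 2 ^ j                  ≤⟨ f[k+j]+2^j≤2^j*f[k]+1 potential potential[1+T]+1≤2*potential[T] k j ⟩
      2 ^ j * potential k + 1                    ≤⟨ +-monoˡ-≤ 1 (*-monoʳ-≤ (2 ^ j) potential[k]≤[k+1]*2^k) ⟩
      2 ^ j * ((k + 1) * 2 ^ k) + 1              ∎)
      where
      open ≤-Reasoning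
      u = undecided n (k + j)
      1≤u+n : 1 ≤ u + n
      1≤u+n = ≤-trans (>-nonZero⁻¹ n) (m≤n+m n u)
      regroup : ∀ q p u n → q + p + (u + n) ≡ q + u + n + p
      regroup = solve-∀

    cappedNumerator-bound : ∀ T → cappedNumerator T * 2 ^ k + 2 ^ T ≤ (k + 1) * (2 ^ T * 2 ^ k)
    cappedNumerator-bound T with ≤-total T k
    ... | inj₁ T≤k rewrite cappedNumerator≡T*2^T T≤k = begin
      T * 2 ^ T * 2 ^ k + 2 ^ T          ≤⟨ +-monoʳ-≤ (T * 2 ^ T * 2 ^ k) (m≤m*n (2 ^ T) (2 ^ k) {{m^n≢0 2 k}}) ⟩
      T * 2 ^ T * 2 ^ k + 2 ^ T * 2 ^ k  ≡⟨ regroup T (2 ^ T) (2 ^ k) ⟩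
      (T + 1) * (2 ^ T * 2 ^ k)          ≤⟨ *-monoˡ-≤ (2 ^ T * 2 ^ k) (+-monoˡ-≤ 1 T≤k) ⟩
      (k + 1) * (2 ^ T * 2 ^ k)          ∎
      where
      open ≤-Reasoning
      regroup : ∀ T p q → T * p * q + p * q ≡ (T + 1) * (p * q)
      regroup = solve-∀
    ... | inj₂ k≤T with m≤n⇒∃[o]m+o≡n k≤T
    ...   | j , refl rewrite ^-distribˡ-+-* 2 k j = begin
      cappedNumerator (k + j) * 2 ^ k + 2 ^ k * 2 ^ j  ≡⟨ regroup (cappedNumerator (k + j)) (2 ^ k) (2 ^ j) ⟩
      (cappedNumerator (k + j) + 2 ^ j) * 2 ^ k         ≤⟨ *-monoˡ-≤ (2 ^ k) (cappedNumerator[k+j]+2^j≤2^j*[k+1]*2^k j) ⟩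
      2 ^ j * ((k + 1) * 2 ^ k) * 2 ^ k                 ≡⟨ reorder (2 ^ j) (k + 1) (2 ^ k) ⟩
      (k + 1) * (2 ^ k * 2 ^ j * 2 ^ k)                 ∎
      where
      open ≤-Reasoning
      regroup : ∀ q p r → q * p + p * r ≡ (q + r) * p
      regroup = solve-∀
      reorder : ∀ r m p → r * (m * p) * p ≡ m * (p * r * p)
      reorder = solve-∀

    partialNumerator-bound : ∀ T → partialNumerator T * 2 ^ k + 2 ^ T ≤ (k + 1) * (2 ^ T * 2 ^ k)
    partialNumerator-bound T = ≤-trans
      (+-monoˡ-≤ (2 ^ T) (*-monoˡ-≤ (2 ^ k) (partialNumerator≤cappedNumerator T))) (cappedNumerator-bound T)

open import Data.Nat using (zero; suc; _^_)
open import Data.Nat.Properties using (m^n≢0)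
open import Data.Nat.Logarithm using (⌈log₂_⌉)
open import Data.Product using (Σ; _×_; _,_)
open import Data.Integer using (+_)
open import Data.Rational using (ℚ; _+_; _≤_; _<_; 0ℚ; _/_)
open import Data.Rational.Properties using (positive⁻¹; normalize-pos)
open import Data.Rational.Unnormalised.Properties using (≃-refl)

proposition8 : (n : ℕ) → .{{_ : NonZero n}} →
    Σ ℚ (λ ε → (0ℚ < ε) ×
    ((T : ℕ) → partialE n T + ε ≤ (+ (⌈log₂ n ⌉ Data.Nat.+ 1) / 1)))
proposition8 n = + 1 / 2 ^ k , positive⁻¹ _ {{normalize-pos 1 (2 ^ k)}} , partialE+ε≤k+1
  where
  k = ⌈log₂ n ⌉
  open Scheme n
  open Threshold {k} <⌈log₂n⌉⇒2^<n (n≤2^⌈log₂n⌉ n)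
  instance
    2^k≢0 : NonZero (2 ^ k)
    2^k≢0 = m^n≢0 2 k
  partialE+ε≤k+1 : ∀ T → partialE n T + + 1 / 2 ^ k ≤ + (k Data.Nat.+ 1) / 1
  partialE+ε≤k+1 zero    = q+1/c≤m/1 0ℚ 0 1 (2 ^ k) (k Data.Nat.+ 1) ≃-refl (partialNumerator-bound 0)
  partialE+ε≤k+1 (suc T) = q+1/c≤m/1 (partialE n (suc T)) (partialNumerator T) (2 ^ T) (2 ^ k) (k Data.Nat.+ 1)
    {{m^n≢0 2 T}} (toℚᵘ-partialE T) (partialNumerator-bound T)
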